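{- Let $G=(V,E)$ be a finite simple graph and $v\in V$. Then $v$ is domination-covered if and only if there is a vertex $u\in N_G(v)$ such that $N_G[u]\subseteq N_G[v]$.
   Context: $N_G(v)$ and $N_G[v]$ are the open and closed neighborhoods of $v$ in $G$. A set $W\subseteq V$ is a dominating set of $G$ if every vertex of $G$ lies in $W$ or is adjacent to a vertex of $W$. A vertex $v$ of $G$ is domination-covered if every dominating set of $G-v$ contains at least one vertex adjacent to $v$ in $G$. -}

module Defs where

open import Data.Nat using (ℕ)
open import Data.Fin using (Fin)
open import Data.Fin.Subset using (Subset; _∈_; _∉_)
open import Data.Product using (Σ; _×_; ∃-syntax)
open import Data.Sum using (_⊎_)
open import Relation.Nullary using (¬_; Dec)
open import Relation.Binary.PropositionalEquality using (_≡_)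

record Graph (n : ℕ) : Set₁ where
  field
    Adj     : Fin n → Fin n → Set
    adj?    : (u w : Fin n) → Dec (Adj u w)
    sym     : ∀ {u w} → Adj u w → Adj w u
    irrefl  : ∀ {u} → ¬ Adj u u

module _ {n : ℕ} (G : Graph n) where
  open Graph G

  InN : Fin n → Fin n → Set
  InN v u = Adj v u

  InN[] : Fin n → Fin n → Set
  InN[] v u = u ≡ v ⊎ Adj v u

  -- W is a dominating set of G - v : W ⊆ V(G) ∖ {v}, and every vertex
  -- x ≠ v lies in W or is adjacent (in G - v, i.e. in G) to a vertex of W.
  IsDominatingSetMinus : Fin n → Subset n → Set
  IsDominatingSetMinus v W =
    (v ∉ W) × (∀ x → ¬ x ≡ v → x ∈ W ⊎ (∃[ w ] (w ∈ W × Adj x w)))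

  DominationCovered : Fin n → Set
  DominationCovered v =
    ∀ (W : Subset n) → IsDominatingSetMinus v W → ∃[ w ] (w ∈ W × Adj v w)

module Submission where

-- (⇐) Let W dominate G - v and let u ∈ N(v) with N[u] ⊆ N[v].  Since u ≠ v,
--     either u ∈ W, or u has a neighbour w ∈ W; then w ∈ N[v] and w ≠ v
--     (as v ∉ W), so w is a neighbour of v in W.
-- (⇒) Suppose no neighbour of v has N[u] ⊆ N[v].  Then the complement
--     V ∖ N[v] dominates G - v: vertices outside N[v] lie in it, and every
--     neighbour u of v has a neighbour outside N[v].  This dominating set
--     contains no neighbour of v, so v is not domination-covered.  Since
--     "N[u] ⊆ N[v]" is decidable on the finite vertex set, this contrapositive
--     argument yields the required neighbour constructively.

open import Defs
open import Level using (Level)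
open import Data.Nat using (ℕ)
open import Data.Fin using (Fin; _≟_)
open import Data.Fin.Properties using (any?; all?; ¬∀⟶∃¬)
open import Data.Fin.Subset using (Subset; _∈_)
open import Data.Product using (_×_; ∃-syntax; _,_)
open import Data.Sum using (_⊎_; inj₁; inj₂)
open import Data.Vec using (tabulate)
open import Data.Vec.Properties using (lookup∘tabulate; []=⇒lookup; lookup⇒[]=)
open import Relation.Nullary using (¬_; Dec; yes; no; does; contradiction)
open import Relation.Nullary.Decidable using (_⊎-dec_; _×-dec_; _→-dec_; ¬?; dec-true)
open import Relation.Unary using (Pred; Decidable)
open import Relation.Binary.PropositionalEquality using (_≡_; refl; sym; trans)
open import Function.Bundles using (_⇔_; mk⇔)

module DecidableSubset {ℓ : Level} {n : ℕ} {P : Pred (Fin n) ℓ} (P? : Decidable P) where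

  subsetOf : Subset n
  subsetOf = tabulate (λ x → does (P? x))

  ∈-subsetOf⁺ : ∀ {x} → P x → x ∈ subsetOf
  ∈-subsetOf⁺ {x} px =
    lookup⇒[]= x subsetOf (trans (lookup∘tabulate _ x) (dec-true (P? x) px))

  ∈-subsetOf⁻ : ∀ {x} → x ∈ subsetOf → P x
  ∈-subsetOf⁻ {x} x∈ with P? x | trans (sym (lookup∘tabulate _ x)) ([]=⇒lookup x∈)
  ... | yes px | _ = px
  ... | no _   | ()

module _ {n : ℕ} (G : Graph n) where
  open Graph G using (Adj; adj?; irrefl)

  _⊆N[]_ : Fin n → Fin n → Set
  u ⊆N[] v = ∀ x → InN[] G u x → InN[] G v x

  -- Membership in a closed neighbourhood, and hence N[u] ⊆ N[v], is
  -- decidable; this is what makes the (⇒) direction constructive.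
  closedNbhd? : ∀ v → Decidable (InN[] G v)
  closedNbhd? v x = (x ≟ v) ⊎-dec adj? v x

  _⊆N[]?_ : ∀ u v → Dec (u ⊆N[] v)
  u ⊆N[]? v = all? (λ x → closedNbhd? u x →-dec closedNbhd? v x)

  -- If u ∈ N[v] but N[u] ⊄ N[v], then u has a neighbour outside N[v]
  -- (the escaping vertex of N[u] cannot be u itself).
  neighbourOutside : ∀ {u v} → InN[] G v u → ¬ (u ⊆N[] v) →
                     ∃[ x ] (¬ InN[] G v x × Adj u x)
  neighbourOutside {u} {v} u∈N[v] u⊈v
    with ¬∀⟶∃¬ n _ (λ x → closedNbhd? u x →-dec closedNbhd? v x) u⊈v
  ... | x , escapes with closedNbhd? v x
  ...   | yes x∈N[v] = contradiction (λ _ → x∈N[v]) escapes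
  ...   | no x∉N[v] with closedNbhd? u x
  ...     | no x∉N[u]         = contradiction (λ x∈N[u] → contradiction x∈N[u] x∉N[u]) escapes
  ...     | yes (inj₁ refl)   = contradiction u∈N[v] x∉N[v]
  ...     | yes (inj₂ u~x)    = x , x∉N[v] , u~x

  -- (⇐) A neighbour u of v with N[u] ⊆ N[v] forces every dominating set of
  -- G - v to meet N(v): it contains u or a neighbour of u, which is in N(v).
  dominatedNeighbour⇒covered : ∀ {u v} → Adj v u → u ⊆N[] v → DominationCovered G v
  dominatedNeighbour⇒covered {u} v~u u⊆v W (v∉W , dominates)
    with dominates u (λ { refl → irrefl v~u })
  ... | inj₁ u∈W = u , u∈W , v~u
  ... | inj₂ (w , w∈W , u~w) with u⊆v w (inj₂ u~w)
  ...   | inj₁ refl = contradiction w∈W v∉W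
  ...   | inj₂ v~w  = w , w∈W , v~w

  module Outside (v : Fin n) where
    open DecidableSubset (λ x → ¬? (closedNbhd? v x)) public
      renaming (subsetOf to outsideN[]; ∈-subsetOf⁺ to ∈-outside⁺; ∈-subsetOf⁻ to ∈-outside⁻)

    outside-dominates : (∀ u → Adj v u → ¬ (u ⊆N[] v)) →
                        IsDominatingSetMinus G v outsideN[]
    outside-dominates noDominated =
      (λ v∈W → ∈-outside⁻ v∈W (inj₁ refl)) , dominates
      where
      dominates : ∀ x → ¬ x ≡ v → x ∈ outsideN[] ⊎ ∃[ w ] (w ∈ outsideN[] × Adj x w)
      dominates x x≢v with closedNbhd? v x
      ... | no x∉N[v]        = inj₁ (∈-outside⁺ x∉N[v])
      ... | yes (inj₁ x≡v)   = contradiction x≡v x≢v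
      ... | yes (inj₂ v~x)   with neighbourOutside (inj₂ v~x) (noDominated x v~x)
      ...   | w , w∉N[v] , x~w = inj₂ (w , ∈-outside⁺ w∉N[v] , x~w)

    -- Hence, without a dominated neighbour, v is not domination-covered:
    -- V ∖ N[v] dominates G - v yet contains no neighbour of v.
    notCovered : (∀ u → Adj v u → ¬ (u ⊆N[] v)) → ¬ DominationCovered G v
    notCovered noDominated covered
      with covered outsideN[] (outside-dominates noDominated)
    ... | w , w∈W , v~w = ∈-outside⁻ w∈W (inj₂ v~w)

  -- (⇒) The existence of a dominated neighbour is decidable, and its
  -- absence contradicts domination-coveredness.
  covered⇒dominatedNeighbour : ∀ {v} → DominationCovered G v →
                               ∃[ u ] (Adj v u × u ⊆N[] v)
  covered⇒dominatedNeighbour {v} covered with any? (λ u → adj? v u ×-dec u ⊆N[]? v)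
  ... | yes found = found
  ... | no none   =
    contradiction covered (Outside.notCovered v (λ u v~u u⊆v → none (u , v~u , u⊆v)))

mainTheorem17 : ∀ {n : ℕ} (G : Graph n) (v : Fin n) →
    DominationCovered G v ⇔
      (∃[ u ] (InN G v u × (∀ x → InN[] G u x → InN[] G v x)))
mainTheorem17 G v =
  mk⇔ (covered⇒dominatedNeighbour G)
      (λ { (u , v~u , u⊆v) → dominatedNeighbour⇒covered G v~u u⊆v })
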